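{- Let $\Gamma=(V,E,o,t)$ be a connected finite graph with finite modulus $\rho\colon I\to V$. The restriction map $j^*\colon C^\bullet(\Gamma_{\mathfrak m})\to C^\bullet(\Gamma)$ induces an exact sequence $0\to\mathbb{Z}^I/\mathbb{Z}\to\mathrm{P}_{\mathfrak m}(\Gamma)\to\mathrm{P}(\Gamma)\to0$, where $\mathbb{Z}\subset\mathbb{Z}^I$ is the constant functions, the first map sends the class of $g$ to the class of $(0,g)\in\mathbb{Z}^E\oplus\mathbb{Z}^I$, and the second sends the class of $(\omega,g)$ to the class of $\omega$.
   Context: Graph: $V\neq\emptyset$, $E$, $o,t\colon E\to V$; finite, connected. Modulus: nonempty finite family $(w_i)_{i\in I}$, $\rho(i)=w_i$. $d\colon\mathbb{Z}^V\to\mathbb{Z}^E$, $(df)(e)=f(t(e))-f(o(e))$, $H^1(\Gamma)=\mathbb{Z}^E/d\mathbb{Z}^V$; $(d^*\omega)(v)=\sum_{t(e)=v}\omega(e)-\sum_{o(e)=v}\omega(e)$, $\mathcal{H}^1(\Gamma)=\ker d^*$; $\mathrm{P}(\Gamma)=H^1(\Gamma)/\mathrm{im}(\mathcal{H}^1(\Gamma))$. Extended graph $\Gamma_{\mathfrak m}$: add vertex $\star$ and edges $e_i$, $o(e_i)=\star$, $t(e_i)=w_i$; cochain complex $C^0(\Gamma_{\mathfrak m})=\mathbb{Z}^V\oplus\mathbb{Z}\xrightarrow{d_{\mathfrak m}}C^1(\Gamma_{\mathfrak m})=\mathbb{Z}^E\oplus\mathbb{Z}^I$, $d_{\mathfrak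 m}(f,a)=(df,f\circ\rho-a)$; $H^1(\Gamma_{\mathfrak m})=\operatorname{coker}d_{\mathfrak m}$. $\mathrm{P}_{\mathfrak m}(\Gamma)=H^1(\Gamma_{\mathfrak m})/\{[(\omega,0)]:\omega\in\mathcal{H}^1(\Gamma)\}$. -}

module Defs where

open import Data.Nat using (ℕ; zero; suc)
open import Data.Fin using (Fin; zero; suc; _≟_)
open import Data.Integer using (ℤ; _+_; _-_; 0ℤ)
open import Data.Product using (Σ; _×_; _,_)
open import Relation.Nullary using (yes; no)
open import Relation.Binary.PropositionalEquality using (_≡_)

record Graph : Set where
  field
    nV nE : ℕ
    o t : Fin nE → Fin nV

ΣF : ∀ {n} → (Fin n → ℤ) → ℤ
ΣF {zero} f = 0ℤ
ΣF {suc n} f = f zero + ΣF (λ i → f (suc i))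

module _ (Γ : Graph) where
  open Graph Γ

  Vtx : Set
  Vtx = Fin nV

  C⁰ : Set
  C⁰ = Fin nV → ℤ

  C¹ : Set
  C¹ = Fin nE → ℤ

  zero¹ : C¹
  zero¹ = λ _ → 0ℤ

  d : C⁰ → C¹
  d f e = f (t e) - f (o e)

  δ : Fin nV → Fin nV → ℤ → ℤ
  δ u v x with u ≟ v
  ... | yes _ = x
  ... | no _ = 0ℤ

  d* : C¹ → C⁰
  d* ω v = ΣF (λ e → δ (t e) v (ω e)) - ΣF (λ e → δ (o e) v (ω e))

  Harmonic : C¹ → Set
  Harmonic ω = ∀ v → d* ω v ≡ 0ℤ

  data Reach : Fin nV → Fin nV → Set where
    here : ∀ {v} → Reach v v
    fwd  : ∀ {u} e → Reach (t e) u → Reach (o e) u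
    bwd  : ∀ {u} e → Reach (o e) u → Reach (t e) u

  Connected : Set
  Connected = ∀ u v → Reach u v

  -- Equality in P(Γ) = H¹(Γ)/im ℋ¹(Γ) = ℤ^E / (d ℤ^V + ℋ¹(Γ)), on representatives
  _∼P_ : C¹ → C¹ → Set
  ω ∼P ω' = Σ C⁰ λ f → Σ C¹ λ η → Harmonic η × (∀ e → ω e - ω' e ≡ d f e + η e)

  module _ {nI : ℕ} (ρ : Fin nI → Fin nV) where
    C¹I : Set
    C¹I = Fin nI → ℤ

    zeroI : C¹I
    zeroI = λ _ → 0ℤ

    -- Equality in P_m(Γ) = (ℤ^E ⊕ ℤ^I) / (im d_m + {(η,0) : η ∈ ℋ¹(Γ)}),
    -- with d_m(f,a) = (df, f∘ρ - a), on representatives (ω,g), (ω',g')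
    ∼Pm : C¹ → C¹I → C¹ → C¹I → Set
    ∼Pm ω g ω' g' =
      Σ C⁰ λ f → Σ ℤ λ a → Σ C¹ λ η → Harmonic η
        × (∀ e → ω e - ω' e ≡ d f e + η e)
        × (∀ i → g i - g' i ≡ f (ρ i) - a)

    -- Equality in ℤ^I / ℤ (ℤ = constant functions)
    _∼I_ : C¹I → C¹I → Set
    g ∼I g' = Σ ℤ λ c → ∀ i → g i - g' i ≡ c

-- Everything except injectivity of g ↦ [(0, g)] is bookkeeping: if ω = d f + η with η harmonic, then
-- (ω, g) − d_m(f, 0) = (η, g − f ∘ ρ). For injectivity, (0, g − g') = d_m(f, a) + (η, 0) forces d f = −η,
-- and d f ⊥ ℋ¹(Γ) because d* is adjoint to d, so Σₑ (d f e)² = −⟨d f, η⟩ = −⟨f, d* η⟩ = 0.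
-- Hence d f = 0, f is constant on the connected graph, and g − g' = f ∘ ρ − a is constant.
module Submission where

open import Defs
open import Data.Nat using (ℕ; zero; suc; z≤n)
open import Data.Fin using (Fin; zero; suc; _≟_)
open import Data.Fin.Properties using (suc-injective)
open import Data.Integer using (ℤ; _+_; _-_; _*_; -_; 0ℤ; -1ℤ; _≤_; +_; -[1+_]; +≤+; nonNegative)
open import Data.Integer.Properties
  using (+-*-semiring; +-*-ring; ≤-refl; ≤-trans; ≤-antisym; +-mono-≤; i≤i+j; i≤j+i; *-zeroʳ; -1*i≡-i;
         neg-involutive; neg-distribʳ-*; +-inverseʳ; +-identityˡ; +-identityʳ; i*j≡0⇒i≡0∨j≡0; i-j≡0⇒i≡j)
open import Data.Integer.Tactic.RingSolver using (solve-∀)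
open import Algebra.Properties.Semiring.Sum +-*-semiring
  using (sum; sum-cong-≗; sum-replicate-zero; ∑-distrib-+; ∑-comm; *-distribˡ-sum)
open import Algebra.Properties.Ring +-*-ring using (x[y-z]≈xy-xz; [y-z]x≈yx-zx; +-inverseʳ-unique)
open import Data.Product using (Σ; _×_; _,_)
open import Data.Sum using (reduce)
open import Function using (_∘_)
open import Relation.Nullary using (yes; no; contradiction)
open import Relation.Binary.PropositionalEquality
  using (_≡_; _≢_; refl; sym; trans; cong; cong₂; subst; module ≡-Reasoning)
open ≡-Reasoning

ΣF≡sum : ∀ {n} (x : Fin n → ℤ) → ΣF x ≡ sum x
ΣF≡sum {zero}  x = refl
ΣF≡sum {suc n} x = cong (_+_ (x zero)) (ΣF≡sum (x ∘ suc))

sum-neg : ∀ {n} (x : Fin n → ℤ) → sum (λ i → - x i) ≡ - sum x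
sum-neg x = begin
  sum (λ i → - x i)      ≡⟨ sum-cong-≗ (λ i → sym (-1*i≡-i (x i))) ⟩
  sum (λ i → -1ℤ * x i)  ≡⟨ sym (*-distribˡ-sum -1ℤ x) ⟩
  -1ℤ * sum x            ≡⟨ -1*i≡-i (sum x) ⟩
  - sum x                ∎

sum-sub : ∀ {n} (x y : Fin n → ℤ) → sum (λ i → x i - y i) ≡ sum x - sum y
sum-sub x y = trans (∑-distrib-+ x (λ i → - y i)) (cong (_+_ (sum x)) (sum-neg y))

sum-single : ∀ {n} (x : Fin n → ℤ) (i : Fin n) → (∀ j → j ≢ i → x j ≡ 0ℤ) → sum x ≡ x i
sum-single {suc n} x zero    x≡0 = begin
  x zero + sum (x ∘ suc)       ≡⟨ cong (_+_ (x zero)) (sum-cong-≗ (λ j → x≡0 (suc j) λ ())) ⟩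
  x zero + sum {n} (λ _ → 0ℤ)  ≡⟨ cong (_+_ (x zero)) (sum-replicate-zero n) ⟩
  x zero + 0ℤ                  ≡⟨ +-identityʳ (x zero) ⟩
  x zero                       ∎
sum-single {suc n} x (suc i) x≡0 = begin
  x zero + sum (x ∘ suc)
    ≡⟨ cong₂ _+_ (x≡0 zero λ ()) (sum-single (x ∘ suc) i (λ j j≢i → x≡0 (suc j) (j≢i ∘ suc-injective))) ⟩
  0ℤ + x (suc i)          ≡⟨ +-identityˡ (x (suc i)) ⟩
  x (suc i)               ∎

0≤sum : ∀ {n} (x : Fin n → ℤ) → (∀ i → 0ℤ ≤ x i) → 0ℤ ≤ sum x
0≤sum {zero}  x 0≤x = ≤-refl
0≤sum {suc n} x 0≤x = +-mono-≤ (0≤x zero) (0≤sum (x ∘ suc) (0≤x ∘ suc))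

term≤sum : ∀ {n} (x : Fin n → ℤ) → (∀ i → 0ℤ ≤ x i) → ∀ i → x i ≤ sum x
term≤sum {suc n} x 0≤x zero =
  i≤i+j (x zero) (sum (x ∘ suc)) {{nonNegative (0≤sum (x ∘ suc) (0≤x ∘ suc))}}
term≤sum {suc n} x 0≤x (suc i) =
  ≤-trans (term≤sum (x ∘ suc) (0≤x ∘ suc) i) (i≤j+i (sum (x ∘ suc)) (x zero) {{nonNegative (0≤x zero)}})

0≤i*i : ∀ i → 0ℤ ≤ i * i
0≤i*i (+ zero)   = +≤+ z≤n
0≤i*i (+ suc n)  = +≤+ z≤n
0≤i*i -[1+ n ]   = +≤+ z≤n

sum-squares≡0⇒≡0 : ∀ {n} (x : Fin n → ℤ) → sum (λ i → x i * x i) ≡ 0ℤ → ∀ i → x i ≡ 0ℤ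
sum-squares≡0⇒≡0 x Σx²≡0 i = reduce (i*j≡0⇒i≡0∨j≡0 (x i) xᵢ²≡0)
  where
  x² : Fin _ → ℤ
  x² j = x j * x j
  xᵢ²≡0 : x² i ≡ 0ℤ
  xᵢ²≡0 = ≤-antisym (subst (x² i ≤_) Σx²≡0 (term≤sum x² (0≤i*i ∘ x) i)) (0≤i*i (x i))

module _ (Γ : Graph) where
  open Graph Γ

  δ-self : ∀ u x → δ Γ u u x ≡ x
  δ-self u x with u ≟ u
  ... | yes _   = refl
  ... | no u≢u = contradiction refl u≢u

  δ-other : ∀ {u v} x → u ≢ v → δ Γ u v x ≡ 0ℤ
  δ-other {u} {v} x u≢v with u ≟ v
  ... | yes u≡v = contradiction u≡v u≢v
  ... | no _    = refl

  δ-zero : ∀ u v → δ Γ u v 0ℤ ≡ 0ℤ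
  δ-zero u v with u ≟ v
  ... | yes _ = refl
  ... | no _  = refl

  d*-sum : ∀ (ω : C¹ Γ) v → d* Γ ω v ≡ sum (λ e → δ Γ (t e) v (ω e)) - sum (λ e → δ Γ (o e) v (ω e))
  d*-sum ω v = cong₂ _-_ (ΣF≡sum (λ e → δ Γ (t e) v (ω e))) (ΣF≡sum (λ e → δ Γ (o e) v (ω e)))

  harmonic-zero : Harmonic Γ (zero¹ Γ)
  harmonic-zero v = begin
    d* Γ (zero¹ Γ) v
      ≡⟨ d*-sum (zero¹ Γ) v ⟩
    sum (λ e → δ Γ (t e) v 0ℤ) - sum (λ e → δ Γ (o e) v 0ℤ)
      ≡⟨ cong₂ _-_ (sum-cong-≗ (λ e → δ-zero (t e) v)) (sum-cong-≗ (λ e → δ-zero (o e) v)) ⟩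
    sum {nE} (λ _ → 0ℤ) - sum {nE} (λ _ → 0ℤ)
      ≡⟨ cong₂ _-_ (sum-replicate-zero nE) (sum-replicate-zero nE) ⟩
    0ℤ
      ∎

  sum-δ : ∀ (f : C⁰ Γ) u x → sum (λ v → f v * δ Γ u v x) ≡ f u * x
  sum-δ f u x = begin
    sum (λ v → f v * δ Γ u v x)
      ≡⟨ sum-single _ u (λ v v≢u → trans (cong (f v *_) (δ-other x (v≢u ∘ sym))) (*-zeroʳ (f v))) ⟩
    f u * δ Γ u u x              ≡⟨ cong (f u *_) (δ-self u x) ⟩
    f u * x                      ∎

  sum-incidence : ∀ (s : Fin nE → Fin nV) (f : C⁰ Γ) (ω : C¹ Γ) →
    sum (λ v → f v * sum (λ e → δ Γ (s e) v (ω e))) ≡ sum (λ e → f (s e) * ω e)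
  sum-incidence s f ω = begin
    sum (λ v → f v * sum (λ e → δ Γ (s e) v (ω e)))
      ≡⟨ sum-cong-≗ (λ v → *-distribˡ-sum (f v) (λ e → δ Γ (s e) v (ω e))) ⟩
    sum (λ v → sum (λ e → f v * δ Γ (s e) v (ω e)))  ≡⟨ ∑-comm (λ v e → f v * δ Γ (s e) v (ω e)) ⟩
    sum (λ e → sum (λ v → f v * δ Γ (s e) v (ω e)))  ≡⟨ sum-cong-≗ (λ e → sum-δ f (s e) (ω e)) ⟩
    sum (λ e → f (s e) * ω e)                        ∎

  d*-adjoint : ∀ (f : C⁰ Γ) (ω : C¹ Γ) → sum (λ v → f v * d* Γ ω v) ≡ sum (λ e → d Γ f e * ω e)
  d*-adjoint f ω = begin
    sum (λ v → f v * d* Γ ω v)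
      ≡⟨ sum-cong-≗ (λ v → trans (cong (f v *_) (d*-sum ω v)) (x[y-z]≈xy-xz (f v) (T v) (O v))) ⟩
    sum (λ v → f v * T v - f v * O v)
      ≡⟨ sum-sub (λ v → f v * T v) (λ v → f v * O v) ⟩
    sum (λ v → f v * T v) - sum (λ v → f v * O v)
      ≡⟨ cong₂ _-_ (sum-incidence t f ω) (sum-incidence o f ω) ⟩
    sum (λ e → f (t e) * ω e) - sum (λ e → f (o e) * ω e)
      ≡⟨ sum-sub (λ e → f (t e) * ω e) (λ e → f (o e) * ω e) ⟨
    sum (λ e → f (t e) * ω e - f (o e) * ω e)
      ≡⟨ sum-cong-≗ (λ e → [y-z]x≈yx-zx (ω e) (f (t e)) (f (o e))) ⟨
    sum (λ e → d Γ f e * ω e)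
      ∎
    where
    T O : C⁰ Γ
    T v = sum (λ e → δ Γ (t e) v (ω e))
    O v = sum (λ e → δ Γ (o e) v (ω e))

  exact⊥harmonic : ∀ (f : C⁰ Γ) {η : C¹ Γ} → Harmonic Γ η → sum (λ e → d Γ f e * η e) ≡ 0ℤ
  exact⊥harmonic f {η} η-harm = begin
    sum (λ e → d Γ f e * η e)  ≡⟨ d*-adjoint f η ⟨
    sum (λ v → f v * d* Γ η v) ≡⟨ sum-cong-≗ (λ v → trans (cong (f v *_) (η-harm v)) (*-zeroʳ (f v))) ⟩
    sum {nV} (λ _ → 0ℤ)        ≡⟨ sum-replicate-zero nV ⟩
    0ℤ                         ∎

  exact+harmonic≡0⇒exact≡0 : ∀ (f : C⁰ Γ) {η : C¹ Γ} → Harmonic Γ η →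
    (∀ e → d Γ f e + η e ≡ 0ℤ) → ∀ e → d Γ f e ≡ 0ℤ
  exact+harmonic≡0⇒exact≡0 f {η} η-harm df+η≡0 = sum-squares≡0⇒≡0 (d Γ f) Σ[df]²≡0
    where
    df*η≡-[df]² : ∀ e → d Γ f e * η e ≡ - (d Γ f e * d Γ f e)
    df*η≡-[df]² e = trans (cong (d Γ f e *_) (+-inverseʳ-unique (d Γ f e) (η e) (df+η≡0 e)))
                          (sym (neg-distribʳ-* (d Γ f e) (d Γ f e)))
    Σ[df]²≡0 : sum (λ e → d Γ f e * d Γ f e) ≡ 0ℤ
    Σ[df]²≡0 = begin
      sum (λ e → d Γ f e * d Γ f e)       ≡⟨ neg-involutive _ ⟨
      - - sum (λ e → d Γ f e * d Γ f e)   ≡⟨ cong -_ (sum-neg (λ e → d Γ f e * d Γ f e)) ⟨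
      - sum (λ e → - (d Γ f e * d Γ f e)) ≡⟨ cong -_ (sum-cong-≗ df*η≡-[df]²) ⟨
      - sum (λ e → d Γ f e * η e)         ≡⟨ cong -_ (exact⊥harmonic f η-harm) ⟩
      0ℤ                                  ∎

  d≡0⇒const-on-Reach : ∀ (f : C⁰ Γ) → (∀ e → d Γ f e ≡ 0ℤ) → ∀ {u v} → Reach Γ u v → f u ≡ f v
  d≡0⇒const-on-Reach f df≡0 here      = refl
  d≡0⇒const-on-Reach f df≡0 (fwd e r) = trans (sym (i-j≡0⇒i≡j _ _ (df≡0 e))) (d≡0⇒const-on-Reach f df≡0 r)
  d≡0⇒const-on-Reach f df≡0 (bwd e r) = trans (i-j≡0⇒i≡j _ _ (df≡0 e)) (d≡0⇒const-on-Reach f df≡0 r)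

  ∼P-refl : ∀ ω → _∼P_ Γ ω ω
  ∼P-refl ω = (λ _ → 0ℤ) , zero¹ Γ , harmonic-zero , (λ e → +-inverseʳ (ω e))

module _ (Γ : Graph) {nI : ℕ} (ρ : Fin nI → Fin (Graph.nV Γ)) where

  incl-respects-∼I : ∀ (g g' : C¹I Γ ρ) → _∼I_ Γ ρ g g' → ∼Pm Γ ρ (zero¹ Γ) g (zero¹ Γ) g'
  incl-respects-∼I g g' (c , g-g'≡c) =
    (λ _ → 0ℤ) , - c , zero¹ Γ , harmonic-zero Γ , (λ _ → refl) , λ i → trans (g-g'≡c i) (c≡0--c c)
    where
    c≡0--c : ∀ c → c ≡ 0ℤ - - c
    c≡0--c = solve-∀

  restrict-respects-∼Pm : ∀ ω g ω' g' → ∼Pm Γ ρ ω g ω' g' → _∼P_ Γ ω ω'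
  restrict-respects-∼Pm _ _ _ _ (f , _ , η , η-harm , ω-ω'≡df+η , _) = f , η , η-harm , ω-ω'≡df+η

  ker-restrict⊆im-incl : ∀ (ω : C¹ Γ) (g : C¹I Γ ρ) → _∼P_ Γ ω (zero¹ Γ) →
    Σ (C¹I Γ ρ) λ h → ∼Pm Γ ρ ω g (zero¹ Γ) h
  ker-restrict⊆im-incl ω g (f , η , η-harm , ω-0≡df+η) =
    (λ i → g i - f (ρ i)) , f , 0ℤ , η , η-harm , ω-0≡df+η , λ i → x-[x-y]≡y-0 (g i) (f (ρ i))
    where
    x-[x-y]≡y-0 : ∀ x y → x - (x - y) ≡ y - 0ℤ
    x-[x-y]≡y-0 = solve-∀

incl-injective : ∀ (Γ : Graph) → Connected Γ → ∀ {k} (ρ : Fin (suc k) → Fin (Graph.nV Γ)) →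
  ∀ (g g' : C¹I Γ ρ) → ∼Pm Γ ρ (zero¹ Γ) g (zero¹ Γ) g' → _∼I_ Γ ρ g g'
incl-injective Γ connected ρ g g' (f , a , η , η-harm , 0≡df+η , g-g'≡fρ-a) =
  f (ρ zero) - a , λ i → trans (g-g'≡fρ-a i) (cong (_- a) (f-const (ρ i) (ρ zero)))
  where
  df≡0 : ∀ e → d Γ f e ≡ 0ℤ
  df≡0 = exact+harmonic≡0⇒exact≡0 Γ f η-harm (sym ∘ 0≡df+η)
  f-const : ∀ u v → f u ≡ f v
  f-const u v = d≡0⇒const-on-Reach Γ f df≡0 (connected u v)

proposition3p7p4 : (Γ : Graph) → Connected Γ →
    (k : ℕ) (ρ : Fin (suc k) → Fin (Graph.nV Γ)) →
    (∀ (g g' : C¹I Γ ρ) → _∼I_ Γ ρ g g' → ∼Pm Γ ρ (zero¹ Γ) g (zero¹ Γ) g')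
    × (∀ (g g' : C¹I Γ ρ) → ∼Pm Γ ρ (zero¹ Γ) g (zero¹ Γ) g' → _∼I_ Γ ρ g g')
    × (∀ (ω : C¹ Γ) (g : C¹I Γ ρ) (ω' : C¹ Γ) (g' : C¹I Γ ρ) → ∼Pm Γ ρ ω g ω' g' → _∼P_ Γ ω ω')
    × (∀ (ω : C¹ Γ) → Σ (C¹ Γ) λ ω' → Σ (C¹I Γ ρ) λ g → _∼P_ Γ ω' ω)
    × (∀ (g : C¹I Γ ρ) → _∼P_ Γ (zero¹ Γ) (zero¹ Γ))
    × (∀ (ω : C¹ Γ) (g : C¹I Γ ρ) → _∼P_ Γ ω (zero¹ Γ) →
         Σ (C¹I Γ ρ) λ h → ∼Pm Γ ρ ω g (zero¹ Γ) h)
proposition3p7p4 Γ connected k ρ =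
    incl-respects-∼I Γ ρ
  , incl-injective Γ connected ρ
  , restrict-respects-∼Pm Γ ρ
  , (λ ω → ω , (λ _ → 0ℤ) , ∼P-refl Γ ω)
  , (λ _ → ∼P-refl Γ (zero¹ Γ))
  , ker-restrict⊆im-incl Γ ρ
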